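{- Let $T$ be a rooted tree and let $X,Y\subset V(T)$ be nonempty. Suppose the root $x$ of $T[X]$ and the root $y$ of $T[Y]$ are not related. Then $T[X\cup Y]$ is the disjoint union of $T[X]$ and $T[Y]$ together with its root $\delta(x,y)$, which is joined by edges to $x$ and to $y$.
   Context: In a rooted tree, $w$ is an ancestor of $v$ (and $v$ a descendant of $w$) if $w$ lies on the path from $v$ to the root (every vertex is its own ancestor and descendant); $v,w$ are related if one is an ancestor of the other; depth is distance from the root. For a vertex set $S$, $\delta(S)$ is the common ancestor of all elements of $S$ of largest depth, and $\delta(x,y)=\delta(\{x,y\})$. For nonempty $X\subset V(T)$, $T[X]$ is the rooted tree with vertex set $\{\delta(v,w):v,w\in X\}$, root $\delta(X)$, in which distinct $x,y$ are adjacent iff one is an ancestor of the other in $T$ and no other vertex of $T[X]$ is a descendant of one and an ancestor of the other. -}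

module Defs where

open import Data.Nat using (ℕ; zero; suc; _≤_; _<_)
open import Data.Fin using (Fin)
open import Data.Fin.Subset using (Subset; _∈_)
open import Data.Product using (Σ; ∃; ∃-syntax; _×_; _,_)
open import Data.Sum using (_⊎_)
open import Relation.Binary.PropositionalEquality using (_≡_; _≢_)
open import Relation.Nullary using (¬_)

iter : {A : Set} → (A → A) → ℕ → A → A
iter f zero    a = a
iter f (suc k) a = f (iter f k a)

-- A (finite) rooted tree on vertex set Fin n, given by a parent map.  These conditions say exactly that the
-- graph {v, parent v} (v ≠ root) is a tree rooted at 'root'.
record RootedTree (n : ℕ) : Set where
  field
    root    : Fin n
    parent  : Fin n → Fin n
    root-fixed : parent root ≡ root
    reaches-root : ∀ v → ∃[ k ] iter parent k v ≡ root

module _ {n : ℕ} (T : RootedTree n) where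
  open RootedTree T

  -- w is an ancestor of v (every vertex is its own ancestor)
  Ancestor : Fin n → Fin n → Set
  Ancestor w v = ∃[ k ] iter parent k v ≡ w

  Related : Fin n → Fin n → Set
  Related v w = Ancestor v w ⊎ Ancestor w v

  IsDepth : Fin n → ℕ → Set
  IsDepth v d = iter parent d v ≡ root × (∀ j → j < d → iter parent j v ≢ root)

  CommonAncestor : (Fin n → Set) → Fin n → Set
  CommonAncestor S a = ∀ s → S s → Ancestor a s

  IsDelta : (Fin n → Set) → Fin n → Set
  IsDelta S a = CommonAncestor S a ×
    (∀ c → CommonAncestor S c → ∀ dc da → IsDepth c dc → IsDepth a da → dc ≤ da)

  ⟦_⟧ : Subset n → Fin n → Set
  ⟦ X ⟧ v = v ∈ X

  pair : Fin n → Fin n → Fin n → Set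
  pair v w z = z ≡ v ⊎ z ≡ w

  IsDelta₂ : Fin n → Fin n → Fin n → Set
  IsDelta₂ v w a = IsDelta (pair v w) a

  -- u is a vertex of T[X], i.e. u = δ(v,w) for some v, w ∈ X
  InInduced : Subset n → Fin n → Set
  InInduced X u = ∃[ v ] ∃[ w ] (v ∈ X × w ∈ X × IsDelta₂ v w u)

  Between : Fin n → Fin n → Fin n → Set
  Between x y z = (Ancestor x z × Ancestor z y) ⊎ (Ancestor y z × Ancestor z x)

  AdjInduced : Subset n → Fin n → Fin n → Set
  AdjInduced X x y =
    InInduced X x × InInduced X y × x ≢ y × Related x y ×
    (∀ z → InInduced X z → z ≢ x → z ≢ y → ¬ Between x y z)

  IsInducedRoot : Subset n → Fin n → Set
  IsInducedRoot X r = IsDelta ⟦ X ⟧ r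

-- Ancestry is a partial order on the vertices in which the ancestors of any vertex form a
-- chain; hence δ(S) is the greatest common ancestor of S, every vertex of T[X] lies below
-- x = δ(X) and x itself is a vertex of T[X]. As x and y are unrelated, no vertex lies below
-- both, so δ(v,w) = δ(x,y) = d whenever v ∈ X and w ∈ Y, and d lies below neither x nor y.
-- Consequently the vertices of T[X ∪ Y] below x are exactly those of T[X], which leaves
-- adjacency between them unchanged, and the only vertices of T[X ∪ Y] from d up to x are
-- d and x themselves, so d–x is an edge.
module Submission where

open import Defs
open import Data.Nat using (ℕ; zero; suc; pred; _+_; _∸_; _≤_; _<_; s≤s)
open import Data.Nat.Properties using (≮⇒≥; ≤-antisym; m∸n≤m; n≮n; pred[m∸n]≡m∸[1+n])
open import Data.Fin using (Fin; _≟_)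
open import Data.Fin.Properties using (any?)
open import Data.Fin.Subset using (Subset; Nonempty; _∈_; _⊆_; _∪_)
open import Data.Fin.Subset.Properties using (_∈?_; p⊆p∪q; q⊆p∪q; x∈p∪q⁻)
open import Data.Product using (∃; ∃-syntax; _×_; _,_; proj₁; proj₂; uncurry)
open import Data.Sum using (_⊎_; inj₁; inj₂; [_,_]′; swap)
open import Data.Empty using (⊥-elim)
open import Function using (_∘_)
open import Function.Bundles using (_⇔_; mk⇔)
open import Relation.Binary.PropositionalEquality using (_≡_; _≢_; refl; sym; trans; cong; subst)
open import Relation.Nullary using (¬_; Dec; yes; no)
open import Relation.Nullary.Decidable using (map′; decidable-stable; _×-dec_; ¬?)

iter-suc : {A : Set} (f : A → A) (k : ℕ) (a : A) → iter f (suc k) a ≡ iter f k (f a)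
iter-suc f zero    a = refl
iter-suc f (suc k) a = cong f (iter-suc f k a)

iter-+ : {A : Set} (f : A → A) (m k : ℕ) (a : A) → iter f (m + k) a ≡ iter f m (iter f k a)
iter-+ f zero    k a = refl
iter-+ f (suc m) k a = cong f (iter-+ f m k a)

iter-fixed : {A : Set} (f : A → A) {a : A} → f a ≡ a → (k : ℕ) → iter f k a ≡ a
iter-fixed f fa≡a zero    = refl
iter-fixed f fa≡a (suc k) = trans (cong f (iter-fixed f fa≡a k)) fa≡a

module _ {n : ℕ} (T : RootedTree n) where
  open RootedTree T

  infix 4 _≼_
  _≼_ : Fin n → Fin n → Set
  a ≼ v = Ancestor T a v

  parent-induction : (P : Fin n → Set) → P root → (∀ {v} → v ≢ root → P (parent v) → P v) →
                     ∀ v → P v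
  parent-induction P base step v = go (proj₁ (reaches-root v)) v (proj₂ (reaches-root v))
    where
    go : ∀ k v → iter parent k v ≡ root → P v
    go k v reaches with v ≟ root
    ... | yes refl = base
    go zero    v reaches | no v≢root = ⊥-elim (v≢root reaches)
    go (suc k) v reaches | no v≢root =
      step v≢root (go k (parent v) (trans (sym (iter-suc parent k v)) reaches))

  ≼-refl : ∀ {v} → v ≼ v
  ≼-refl = 0 , refl

  ≼-trans : ∀ {a b c} → a ≼ b → b ≼ c → a ≼ c
  ≼-trans {c = c} (k , refl) (m , refl) = k + m , iter-+ parent k m c

  root-≼ : ∀ v → root ≼ v
  root-≼ = reaches-root

  ≼-root⇒≡ : ∀ {a} → a ≼ root → a ≡ root
  ≼-root⇒≡ (k , reaches) = trans (sym reaches) (iter-fixed parent root-fixed k)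

  ≼-step : ∀ {a v} → a ≼ parent v → a ≼ v
  ≼-step {v = v} (k , reaches) = suc k , trans (iter-suc parent k v) reaches

  ≼-unstep : ∀ {a v} → a ≼ v → a ≢ v → a ≼ parent v
  ≼-unstep (zero  , v≡a) a≢v = ⊥-elim (a≢v (sym v≡a))
  ≼-unstep {v = v} (suc k , reaches) _ = k , trans (sym (iter-suc parent k v)) reaches

  ≼-related : ∀ {a b v} → a ≼ v → b ≼ v → Related T a b
  ≼-related {v = v} = parent-induction (λ v → ∀ {a b} → a ≼ v → b ≼ v → Related T a b) base step v
    where
    base : ∀ {a b} → a ≼ root → b ≼ root → Related T a b
    base {b = b} a≼root _ = inj₁ (subst (_≼ b) (sym (≼-root⇒≡ a≼root)) (root-≼ b))
    step : ∀ {v} → v ≢ root → (∀ {a b} → a ≼ parent v → b ≼ parent v → Related T a b) →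
           ∀ {a b} → a ≼ v → b ≼ v → Related T a b
    step {v} _ ih {a} {b} a≼v b≼v with a ≟ v | b ≟ v
    ... | yes refl | _        = inj₂ b≼v
    ... | no _     | yes refl = inj₁ a≼v
    ... | no a≢v   | no b≢v   = ih (≼-unstep a≼v a≢v) (≼-unstep b≼v b≢v)

  _≼?_ : ∀ a v → Dec (a ≼ v)
  a ≼? v = parent-induction (λ v → Dec (a ≼ v)) (map′ (λ { refl → ≼-refl }) ≼-root⇒≡ (a ≟ root)) step v
    where
    step : ∀ {v} → v ≢ root → Dec (a ≼ parent v) → Dec (a ≼ v)
    step {v} _ a≼?pv with a ≟ v
    ... | yes refl = yes ≼-refl
    ... | no a≢v   = map′ ≼-step (λ a≼v → ≼-unstep a≼v a≢v) a≼?pv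

  child-toward : ∀ {a v} → a ≼ v → a ≢ v → ∃[ c ] (parent c ≡ a × c ≢ a × c ≼ v)
  child-toward {v = v} = parent-induction P base step v
    where
    P : Fin n → Set
    P v = ∀ {a} → a ≼ v → a ≢ v → ∃[ c ] (parent c ≡ a × c ≢ a × c ≼ v)
    base : P root
    base a≼root a≢root = ⊥-elim (a≢root (≼-root⇒≡ a≼root))
    step : ∀ {v} → v ≢ root → P (parent v) → P v
    step {v} _ ih {a} a≼v a≢v with parent v ≟ a
    ... | yes pv≡a = v , pv≡a , a≢v ∘ sym , ≼-refl
    ... | no pv≢a with ih (≼-unstep a≼v a≢v) (pv≢a ∘ sym)
    ...   | c , pc≡a , c≢a , c≼pv = c , pc≡a , c≢a , ≼-step c≼pv

  depth-unique : ∀ {v d e} → IsDepth T v d → IsDepth T v e → d ≡ e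
  depth-unique (reaches-d , below-d) (reaches-e , below-e) =
    ≤-antisym (≮⇒≥ (λ e<d → below-d _ e<d reaches-e)) (≮⇒≥ (λ d<e → below-e _ d<e reaches-d))

  depth-exists : ∀ v → ∃ (IsDepth T v)
  depth-exists = parent-induction (λ v → ∃ (IsDepth T v)) (0 , refl , λ _ ()) step
    where
    step : ∀ {v} → v ≢ root → ∃ (IsDepth T (parent v)) → ∃ (IsDepth T v)
    step {v} v≢root (d , reaches , below) = suc d , trans (iter-suc parent d v) reaches , below′
      where
      below′ : ∀ j → j < suc d → iter parent j v ≢ root
      below′ zero    _         = v≢root
      below′ (suc j) (s≤s j<d) = below j j<d ∘ trans (sym (iter-suc parent j v))

  depth-parent : ∀ {v d} → IsDepth T v d → IsDepth T (parent v) (pred d)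
  depth-parent {v} {zero} (v≡root , _) = trans (cong parent v≡root) root-fixed , λ _ ()
  depth-parent {v} {suc d} (reaches , below) =
    trans (sym (iter-suc parent d v)) reaches ,
    λ j j<d → below (suc j) (s≤s j<d) ∘ trans (iter-suc parent j v)

  depth-iter : ∀ {v d} k → IsDepth T v d → IsDepth T (iter parent k v) (d ∸ k)
  depth-iter         zero    v-depth = v-depth
  depth-iter {d = d} (suc k) v-depth =
    subst (IsDepth T _) (pred[m∸n]≡m∸[1+n] d k) (depth-parent (depth-iter k v-depth))

  ≼-depth-≤ : ∀ {c a dc da} → c ≼ a → IsDepth T c dc → IsDepth T a da → dc ≤ da
  ≼-depth-≤ {da = da} (k , refl) c-depth a-depth =
    subst (_≤ da) (depth-unique (depth-iter k a-depth) c-depth) (m∸n≤m da k)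

  ≼-depth-≡ : ∀ {c a d} → c ≼ a → IsDepth T c d → IsDepth T a d → c ≡ a
  ≼-depth-≡ (zero , refl) _ _ = refl
  ≼-depth-≡ {d = zero} (suc k , refl) (c≡root , _) (a≡root , _) = trans c≡root (sym a≡root)
  ≼-depth-≡ {d = suc d} (suc k , refl) c-depth a-depth =
    ⊥-elim (n≮n d (subst (_≤ d) (depth-unique (depth-iter (suc k) a-depth) c-depth) (m∸n≤m d k)))

  ≼-antisym : ∀ {a b} → a ≼ b → b ≼ a → a ≡ b
  ≼-antisym {a} {b} a≼b b≼a with depth-exists a | depth-exists b
  ... | da , a-depth | db , b-depth =
    ≼-depth-≡ a≼b a-depth (subst (IsDepth T b) (≤-antisym (≼-depth-≤ b≼a b-depth a-depth)
                                                           (≼-depth-≤ a≼b a-depth b-depth)) b-depth)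

  IsLCA : (Fin n → Set) → Fin n → Set
  IsLCA S a = CommonAncestor T S a × (∀ c → CommonAncestor T S c → c ≼ a)

  IsLCA⇒IsDelta : ∀ {S a} → IsLCA S a → IsDelta T S a
  IsLCA⇒IsDelta (common , greatest) =
    common , λ c c-common _ _ c-depth a-depth → ≼-depth-≤ (greatest c c-common) c-depth a-depth

  IsDelta⇒IsLCA : ∀ {S a s} → S s → IsDelta T S a → IsLCA S a
  IsDelta⇒IsLCA {S} {a} {s} s∈S (common , deepest) = common , greatest
    where
    greatest : ∀ c → CommonAncestor T S c → c ≼ a
    greatest c c-common with ≼-related (c-common s s∈S) (common s s∈S)
    ... | inj₁ c≼a = c≼a
    ... | inj₂ a≼c with depth-exists c | depth-exists a
    ...   | dc , c-depth | da , a-depth =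
      subst (_≼ a) (≼-depth-≡ a≼c a-depth (subst (IsDepth T c) dc≡da c-depth)) ≼-refl
      where
      dc≡da : dc ≡ da
      dc≡da = ≤-antisym (deepest c c-common dc da c-depth a-depth) (≼-depth-≤ a≼c a-depth c-depth)

  IsLCA₂ : Fin n → Fin n → Fin n → Set
  IsLCA₂ v w a = a ≼ v × a ≼ w × (∀ c → c ≼ v → c ≼ w → c ≼ a)

  pair-common-ancestor : ∀ {c v w} → c ≼ v → c ≼ w → CommonAncestor T (pair T v w) c
  pair-common-ancestor c≼v _ _ (inj₁ refl) = c≼v
  pair-common-ancestor _ c≼w _ (inj₂ refl) = c≼w

  IsLCA₂⇒IsDelta₂ : ∀ {v w a} → IsLCA₂ v w a → IsDelta₂ T v w a
  IsLCA₂⇒IsDelta₂ {v} {w} (a≼v , a≼w , greatest) = IsLCA⇒IsDelta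
    (pair-common-ancestor a≼v a≼w , λ c c-common → greatest c (c-common v (inj₁ refl)) (c-common w (inj₂ refl)))

  IsDelta₂⇒IsLCA₂ : ∀ {v w a} → IsDelta₂ T v w a → IsLCA₂ v w a
  IsDelta₂⇒IsLCA₂ {v} {w} δ with IsDelta⇒IsLCA (inj₁ refl) δ
  ... | common , greatest =
    common v (inj₁ refl) , common w (inj₂ refl) , λ c c≼v c≼w → greatest c (pair-common-ancestor c≼v c≼w)

  lca-sym : ∀ {v w a} → IsLCA₂ v w a → IsLCA₂ w v a
  lca-sym (a≼v , a≼w , greatest) = a≼w , a≼v , λ c c≼w c≼v → greatest c c≼v c≼w

  lca-unique : ∀ {v w a b} → IsLCA₂ v w a → IsLCA₂ v w b → a ≡ b
  lca-unique (a≼v , a≼w , greatest-a) (b≼v , b≼w , greatest-b) =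
    ≼-antisym (greatest-b _ a≼v a≼w) (greatest-a _ b≼v b≼w)

  lca-exists : ∀ v w → ∃ (IsLCA₂ v w)
  lca-exists v w = parent-induction (λ v → ∃ (IsLCA₂ v w))
                                    (root , ≼-refl , root-≼ w , λ _ c≼root _ → c≼root) step v
    where
    step : ∀ {v} → v ≢ root → ∃ (IsLCA₂ (parent v) w) → ∃ (IsLCA₂ v w)
    step {v} _ (d , d≼pv , d≼w , greatest) with v ≼? w
    ... | yes v≼w = v , ≼-refl , v≼w , λ _ c≼v _ → c≼v
    ... | no v⋠w  = d , ≼-step d≼pv , d≼w ,
                    λ c c≼v c≼w → greatest c (≼-unstep c≼v (λ { refl → v⋠w c≼w })) c≼w

  lca-∪ : ∀ {X Y x y d} → IsLCA (_∈ X) x → IsLCA (_∈ Y) y → IsLCA₂ x y d → IsLCA (_∈ X ∪ Y) d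
  lca-∪ {X} {Y} {d = d} (x≼X , greatest-x) (y≼Y , greatest-y) (d≼x , d≼y , greatest) = common , greatest′
    where
    common : CommonAncestor T (_∈ X ∪ Y) d
    common z z∈X∪Y with x∈p∪q⁻ X Y z∈X∪Y
    ... | inj₁ z∈X = ≼-trans d≼x (x≼X z z∈X)
    ... | inj₂ z∈Y = ≼-trans d≼y (y≼Y z z∈Y)
    greatest′ : ∀ c → CommonAncestor T (_∈ X ∪ Y) c → c ≼ d
    greatest′ c c-common = greatest c (greatest-x c (λ z → c-common z ∘ p⊆p∪q Y))
                                      (greatest-y c (λ z → c-common z ∘ q⊆p∪q X Y))

  unrelated-below : ∀ {x y u v} → ¬ Related T x y → x ≼ u → y ≼ v → ¬ Related T u v
  unrelated-below x≁y x≼u y≼v (inj₁ u≼v) = x≁y (≼-related (≼-trans x≼u u≼v) y≼v)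
  unrelated-below x≁y x≼u y≼v (inj₂ v≼u) = x≁y (≼-related x≼u (≼-trans y≼v v≼u))

  lca-of-descendants : ∀ {x y v w d} → ¬ Related T x y → x ≼ v → y ≼ w →
                       IsLCA₂ x y d → IsLCA₂ v w d
  lca-of-descendants x≁y x≼v y≼w (d≼x , d≼y , greatest) =
    ≼-trans d≼x x≼v , ≼-trans d≼y y≼w ,
    λ c c≼v c≼w → greatest c (above x≁y x≼v y≼w c≼v c≼w) (above (x≁y ∘ swap) y≼w x≼v c≼w c≼v)
    where
    above : ∀ {x y v w c} → ¬ Related T x y → x ≼ v → y ≼ w → c ≼ v → c ≼ w → c ≼ x
    above x≁y x≼v y≼w c≼v c≼w with ≼-related c≼v x≼v
    ... | inj₁ c≼x = c≼x
    ... | inj₂ x≼c = ⊥-elim (x≁y (≼-related (≼-trans x≼c c≼w) y≼w))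

  InInduced-mono : ∀ {X Y u} → X ⊆ Y → InInduced T X u → InInduced T Y u
  InInduced-mono X⊆Y (v , w , v∈X , w∈X , δ) = v , w , X⊆Y v∈X , X⊆Y w∈X , δ

  induced-below-root : ∀ {X x u} → IsLCA (_∈ X) x → InInduced T X u → x ≼ u
  induced-below-root (x≼X , _) (v , w , v∈X , w∈X , δ) with IsDelta₂⇒IsLCA₂ δ
  ... | _ , _ , greatest = greatest _ (x≼X v v∈X) (x≼X w w∈X)

  -- x = δ(s, w) for any s ∈ X and any w ∈ X outside the subtree of the child of x toward s.
  induced-root-∈ : ∀ {X x s} → s ∈ X → IsLCA (_∈ X) x → InInduced T X x
  induced-root-∈ {X} {x} {s} s∈X (x≼X , greatest) with x ≟ s
  ... | yes refl = x , x , s∈X , s∈X , IsLCA₂⇒IsDelta₂ (≼-refl , ≼-refl , λ _ c≼x _ → c≼x)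
  ... | no x≢s with child-toward (x≼X s s∈X) x≢s
  ...   | c , pc≡x , c≢x , c≼s with any? (λ w → w ∈? X ×-dec ¬? (c ≼? w))
  ...     | no none =
    ⊥-elim (c≢x (≼-antisym (greatest c (λ w w∈X → decidable-stable (c ≼? w) (λ c⋠w → none (w , w∈X , c⋠w))))
                           (1 , pc≡x)))
  ...     | yes (w , w∈X , c⋠w) =
    s , w , s∈X , w∈X , IsLCA₂⇒IsDelta₂ (x≼X s s∈X , x≼X w w∈X , below)
    where
    below : ∀ e → e ≼ s → e ≼ w → e ≼ x
    below e e≼s e≼w with ≼-related c≼s e≼s
    ... | inj₁ c≼e = ⊥-elim (c⋠w (≼-trans c≼e e≼w))
    ... | inj₂ e≼c with e ≟ c
    ...   | yes refl = ⊥-elim (c⋠w e≼w)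
    ...   | no e≢c   = subst (e ≼_) pc≡x (≼-unstep e≼c e≢c)

  Adjacent : (Fin n → Set) → Fin n → Fin n → Set
  Adjacent V u v = V u × V v × u ≢ v × Related T u v × (∀ z → V z → z ≢ u → z ≢ v → ¬ Between T u v z)

  adjacent-sym : ∀ {V u v} → Adjacent V u v → Adjacent V v u
  adjacent-sym (u∈V , v∈V , u≢v , u~v , no-between) =
    v∈V , u∈V , u≢v ∘ sym , swap u~v , λ z z∈V z≢v z≢u → no-between z z∈V z≢u z≢v ∘ swap

  adjacent-between : ∀ {V u v z} → Adjacent V u v → V z → Between T u v z → z ≡ u ⊎ z ≡ v
  adjacent-between {_} {u} {v} {z} (_ , _ , _ , _ , no-between) z∈V between with z ≟ u | z ≟ v
  ... | yes z≡u | _       = inj₁ z≡u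
  ... | no _    | yes z≡v = inj₂ z≡v
  ... | no z≢u  | no z≢v  = ⊥-elim (no-between z z∈V z≢u z≢v between)

  adjacent-restrict : ∀ {V W u v} → (∀ {z} → W z → V z) → W u → W v → Adjacent V u v → Adjacent W u v
  adjacent-restrict W⊆V u∈W v∈W (_ , _ , u≢v , u~v , no-between) =
    u∈W , v∈W , u≢v , u~v , λ z → no-between z ∘ W⊆V

  adjacent-extend : ∀ {V W u v} → (∀ {z} → W z → V z) → (∀ {z} → V z → u ≼ z ⊎ v ≼ z → W z) →
                    Adjacent W u v → Adjacent V u v
  adjacent-extend W⊆V below-in-W (u∈W , v∈W , u≢v , u~v , no-between) =
    W⊆V u∈W , W⊆V v∈W , u≢v , u~v ,
    λ z z∈V z≢u z≢v between → no-between z (below-in-W z∈V (first between)) z≢u z≢v between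
    where
    first : ∀ {u v z} → Between T u v z → u ≼ z ⊎ v ≼ z
    first (inj₁ (u≼z , _)) = inj₁ u≼z
    first (inj₂ (v≼z , _)) = inj₂ v≼z

  between-interval : ∀ {a b z} → a ≼ b → Between T a b z → a ≼ z × z ≼ b
  between-interval a≼b (inj₁ a≼z≼b)        = a≼z≼b
  between-interval a≼b (inj₂ (b≼z , z≼a)) = ≼-trans a≼b b≼z , ≼-trans z≼a a≼b

  adjacent-cover : ∀ {V a b} → V a → V b → a ≼ b → a ≢ b →
                   (∀ {z} → V z → a ≼ z → z ≼ b → z ≡ a ⊎ z ≡ b) → Adjacent V a b
  adjacent-cover a∈V b∈V a≼b a≢b interval =
    a∈V , b∈V , a≢b , inj₁ a≼b ,
    λ z z∈V z≢a z≢b → [ z≢a , z≢b ]′ ∘ uncurry (interval z∈V) ∘ between-interval a≼b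

  module Union {X Y : Subset n} {x y d s t : Fin n} (x≁y : ¬ Related T x y)
               (x-root : IsLCA (_∈ X) x) (y-root : IsLCA (_∈ Y) y) (d-lca : IsLCA₂ x y d)
               (s∈X : s ∈ X) (t∈Y : t ∈ Y) where

    T[X] T[Y] T[X∪Y] : Fin n → Set
    T[X]   = InInduced T X
    T[Y]   = InInduced T Y
    T[X∪Y] = InInduced T (X ∪ Y)

    d≼x : d ≼ x
    d≼x = proj₁ d-lca

    d≼y : d ≼ y
    d≼y = proj₁ (proj₂ d-lca)

    x≢d : x ≢ d
    x≢d x≡d = x≁y (inj₁ (subst (_≼ y) (sym x≡d) d≼y))

    y≢d : y ≢ d
    y≢d y≡d = x≁y (inj₂ (subst (_≼ x) (sym y≡d) d≼x))

    x≼ : ∀ {u} → T[X] u → x ≼ u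
    x≼ = induced-below-root x-root

    y≼ : ∀ {u} → T[Y] u → y ≼ u
    y≼ = induced-below-root y-root

    T[X]⊆T[X∪Y] : ∀ {u} → T[X] u → T[X∪Y] u
    T[X]⊆T[X∪Y] = InInduced-mono (p⊆p∪q Y)

    T[Y]⊆T[X∪Y] : ∀ {u} → T[Y] u → T[X∪Y] u
    T[Y]⊆T[X∪Y] = InInduced-mono (q⊆p∪q X Y)

    d∈T[X∪Y] : T[X∪Y] d
    d∈T[X∪Y] = s , t , p⊆p∪q Y s∈X , q⊆p∪q X Y t∈Y ,
      IsLCA₂⇒IsDelta₂ (lca-of-descendants x≁y (proj₁ x-root s s∈X) (proj₁ y-root t t∈Y) d-lca)

    classify : ∀ {u} → T[X∪Y] u → T[X] u ⊎ T[Y] u ⊎ u ≡ d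
    classify (v , w , v∈X∪Y , w∈X∪Y , δ) with x∈p∪q⁻ X Y v∈X∪Y | x∈p∪q⁻ X Y w∈X∪Y
    ... | inj₁ v∈X | inj₁ w∈X = inj₁ (v , w , v∈X , w∈X , δ)
    ... | inj₂ v∈Y | inj₂ w∈Y = inj₂ (inj₁ (v , w , v∈Y , w∈Y , δ))
    ... | inj₁ v∈X | inj₂ w∈Y = inj₂ (inj₂ (lca-unique (IsDelta₂⇒IsLCA₂ δ)
      (lca-of-descendants x≁y (proj₁ x-root v v∈X) (proj₁ y-root w w∈Y) d-lca)))
    ... | inj₂ v∈Y | inj₁ w∈X = inj₂ (inj₂ (lca-unique (IsDelta₂⇒IsLCA₂ δ)
      (lca-of-descendants (x≁y ∘ swap) (proj₁ y-root v v∈Y) (proj₁ x-root w w∈X) (lca-sym d-lca))))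

    vertices : ∀ u → T[X∪Y] u ⇔ (T[X] u ⊎ T[Y] u ⊎ u ≡ d)
    vertices u = mk⇔ classify [ T[X]⊆T[X∪Y] , [ T[Y]⊆T[X∪Y] , (λ { refl → d∈T[X∪Y] }) ]′ ]′

    disjoint : ∀ u → ¬ (T[X] u × T[Y] u)
    disjoint u (u∈T[X] , u∈T[Y]) = unrelated-below x≁y (x≼ u∈T[X]) (y≼ u∈T[Y]) (inj₁ ≼-refl)

    d∉T[X] : ¬ T[X] d
    d∉T[X] d∈T[X] = x≁y (inj₁ (≼-trans (x≼ d∈T[X]) d≼y))

    d∉T[Y] : ¬ T[Y] d
    d∉T[Y] d∈T[Y] = x≁y (inj₂ (≼-trans (y≼ d∈T[Y]) d≼x))

    below-x : ∀ {z} → T[X∪Y] z → x ≼ z → T[X] z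
    below-x z∈ x≼z with classify z∈
    ... | inj₁ z∈T[X]        = z∈T[X]
    ... | inj₂ (inj₁ z∈T[Y]) = ⊥-elim (unrelated-below x≁y x≼z (y≼ z∈T[Y]) (inj₁ ≼-refl))
    ... | inj₂ (inj₂ refl)   = ⊥-elim (x≁y (inj₁ (≼-trans x≼z d≼y)))

    below-y : ∀ {z} → T[X∪Y] z → y ≼ z → T[Y] z
    below-y z∈ y≼z with classify z∈
    ... | inj₁ z∈T[X]        = ⊥-elim (unrelated-below x≁y (x≼ z∈T[X]) y≼z (inj₁ ≼-refl))
    ... | inj₂ (inj₁ z∈T[Y]) = z∈T[Y]
    ... | inj₂ (inj₂ refl)   = ⊥-elim (x≁y (inj₂ (≼-trans y≼z d≼x)))

    edge-T[X]⇒edge-T[X∪Y] : ∀ {u v} → Adjacent T[X] u v → Adjacent T[X∪Y] u v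
    edge-T[X]⇒edge-T[X∪Y] adj@(u∈ , v∈ , _) =
      adjacent-extend T[X]⊆T[X∪Y] (λ z∈ → below-x z∈ ∘ [ ≼-trans (x≼ u∈) , ≼-trans (x≼ v∈) ]′) adj

    edge-T[Y]⇒edge-T[X∪Y] : ∀ {u v} → Adjacent T[Y] u v → Adjacent T[X∪Y] u v
    edge-T[Y]⇒edge-T[X∪Y] adj@(u∈ , v∈ , _) =
      adjacent-extend T[Y]⊆T[X∪Y] (λ z∈ → below-y z∈ ∘ [ ≼-trans (y≼ u∈) , ≼-trans (y≼ v∈) ]′) adj

    d-adjacent-x : Adjacent T[X∪Y] d x
    d-adjacent-x =
      adjacent-cover d∈T[X∪Y] (T[X]⊆T[X∪Y] (induced-root-∈ s∈X x-root)) d≼x (x≢d ∘ sym) interval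
      where
      interval : ∀ {z} → T[X∪Y] z → d ≼ z → z ≼ x → z ≡ d ⊎ z ≡ x
      interval z∈ _ z≼x with classify z∈
      ... | inj₁ z∈T[X]        = inj₂ (≼-antisym z≼x (x≼ z∈T[X]))
      ... | inj₂ (inj₁ z∈T[Y]) = ⊥-elim (x≁y (inj₂ (≼-trans (y≼ z∈T[Y]) z≼x)))
      ... | inj₂ (inj₂ z≡d)    = inj₁ z≡d

    d-adjacent-y : Adjacent T[X∪Y] d y
    d-adjacent-y =
      adjacent-cover d∈T[X∪Y] (T[Y]⊆T[X∪Y] (induced-root-∈ t∈Y y-root)) d≼y (y≢d ∘ sym) interval
      where
      interval : ∀ {z} → T[X∪Y] z → d ≼ z → z ≼ y → z ≡ d ⊎ z ≡ y
      interval z∈ _ z≼y with classify z∈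
      ... | inj₁ z∈T[X]        = ⊥-elim (x≁y (inj₁ (≼-trans (x≼ z∈T[X]) z≼y)))
      ... | inj₂ (inj₁ z∈T[Y]) = inj₂ (≼-antisym z≼y (y≼ z∈T[Y]))
      ... | inj₂ (inj₂ z≡d)    = inj₁ z≡d

    adjacent-d⇒≡x : ∀ {u} → T[X] u → Adjacent T[X∪Y] u d → u ≡ x
    adjacent-d⇒≡x u∈T[X] adj
      with adjacent-between adj (T[X]⊆T[X∪Y] (induced-root-∈ s∈X x-root)) (inj₂ (d≼x , x≼ u∈T[X]))
    ... | inj₁ x≡u = sym x≡u
    ... | inj₂ x≡d = ⊥-elim (x≢d x≡d)

    adjacent-d⇒≡y : ∀ {u} → T[Y] u → Adjacent T[X∪Y] u d → u ≡ y
    adjacent-d⇒≡y u∈T[Y] adj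
      with adjacent-between adj (T[Y]⊆T[X∪Y] (induced-root-∈ t∈Y y-root)) (inj₂ (d≼y , y≼ u∈T[Y]))
    ... | inj₁ y≡u = sym y≡u
    ... | inj₂ y≡d = ⊥-elim (y≢d y≡d)

    UnionEdge : Fin n → Fin n → Set
    UnionEdge u v = Adjacent T[X] u v ⊎ Adjacent T[Y] u v
                  ⊎ (u ≡ d × (v ≡ x ⊎ v ≡ y)) ⊎ (v ≡ d × (u ≡ x ⊎ u ≡ y))

    edges⇒ : ∀ {u v} → Adjacent T[X∪Y] u v → UnionEdge u v
    edges⇒ adj@(u∈ , v∈ , u≢v , u~v , _) with classify u∈ | classify v∈
    ... | inj₁ u∈X        | inj₁ v∈X        = inj₁ (adjacent-restrict T[X]⊆T[X∪Y] u∈X v∈X adj)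
    ... | inj₁ u∈X        | inj₂ (inj₁ v∈Y) = ⊥-elim (unrelated-below x≁y (x≼ u∈X) (y≼ v∈Y) u~v)
    ... | inj₁ u∈X        | inj₂ (inj₂ refl) = inj₂ (inj₂ (inj₂ (refl , inj₁ (adjacent-d⇒≡x u∈X adj))))
    ... | inj₂ (inj₁ u∈Y) | inj₁ v∈X        = ⊥-elim (unrelated-below x≁y (x≼ v∈X) (y≼ u∈Y) (swap u~v))
    ... | inj₂ (inj₁ u∈Y) | inj₂ (inj₁ v∈Y) = inj₂ (inj₁ (adjacent-restrict T[Y]⊆T[X∪Y] u∈Y v∈Y adj))
    ... | inj₂ (inj₁ u∈Y) | inj₂ (inj₂ refl) = inj₂ (inj₂ (inj₂ (refl , inj₂ (adjacent-d⇒≡y u∈Y adj))))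
    ... | inj₂ (inj₂ refl) | inj₁ v∈X =
      inj₂ (inj₂ (inj₁ (refl , inj₁ (adjacent-d⇒≡x v∈X (adjacent-sym adj)))))
    ... | inj₂ (inj₂ refl) | inj₂ (inj₁ v∈Y) =
      inj₂ (inj₂ (inj₁ (refl , inj₂ (adjacent-d⇒≡y v∈Y (adjacent-sym adj)))))
    ... | inj₂ (inj₂ refl) | inj₂ (inj₂ refl) = ⊥-elim (u≢v refl)

    edges⇐ : ∀ {u v} → UnionEdge u v → Adjacent T[X∪Y] u v
    edges⇐ (inj₁ adj)                                = edge-T[X]⇒edge-T[X∪Y] adj
    edges⇐ (inj₂ (inj₁ adj))                         = edge-T[Y]⇒edge-T[X∪Y] adj
    edges⇐ (inj₂ (inj₂ (inj₁ (refl , inj₁ refl))))   = d-adjacent-x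
    edges⇐ (inj₂ (inj₂ (inj₁ (refl , inj₂ refl))))   = d-adjacent-y
    edges⇐ (inj₂ (inj₂ (inj₂ (refl , inj₁ refl))))   = adjacent-sym d-adjacent-x
    edges⇐ (inj₂ (inj₂ (inj₂ (refl , inj₂ refl))))   = adjacent-sym d-adjacent-y

    edges : ∀ u v → Adjacent T[X∪Y] u v ⇔ UnionEdge u v
    edges u v = mk⇔ edges⇒ edges⇐

claim1 : ∀ {n} (T : RootedTree n) (X Y : Subset n) → Nonempty X → Nonempty Y →
    (x y : Fin n) → IsInducedRoot T X x → IsInducedRoot T Y y → ¬ Related T x y →
    ∃[ d ] (IsDelta₂ T x y d
      -- d is the root of T[X ∪ Y]
      × IsInducedRoot T (X ∪ Y) d
      -- vertex set: disjoint union of V(T[X]), V(T[Y]) and {d}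
      × (∀ u → InInduced T (X ∪ Y) u ⇔ (InInduced T X u ⊎ InInduced T Y u ⊎ u ≡ d))
      × (∀ u → ¬ (InInduced T X u × InInduced T Y u))
      × ¬ InInduced T X d × ¬ InInduced T Y d
      -- edges: those of T[X], those of T[Y], and d–x, d–y
      × (∀ u v → AdjInduced T (X ∪ Y) u v ⇔
           (AdjInduced T X u v ⊎ AdjInduced T Y u v
            ⊎ (u ≡ d × (v ≡ x ⊎ v ≡ y)) ⊎ (v ≡ d × (u ≡ x ⊎ u ≡ y)))))
claim1 T X Y (s , s∈X) (t , t∈Y) x y x-root y-root x≁y with lca-exists T x y
... | d , d-lca =
  d , IsLCA₂⇒IsDelta₂ T d-lca , IsLCA⇒IsDelta T (lca-∪ T x-lca y-lca d-lca) ,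
  vertices , disjoint , d∉T[X] , d∉T[Y] , edges
  where
  x-lca : IsLCA T (_∈ X) x
  x-lca = IsDelta⇒IsLCA T s∈X x-root
  y-lca : IsLCA T (_∈ Y) y
  y-lca = IsDelta⇒IsLCA T t∈Y y-root
  open Union T x≁y x-lca y-lca d-lca s∈X t∈Y
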